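{- Let $m$ be a square-free positive integer, $p\nmid m$ a prime and $c\in\mathbb Z_p^\nu$. Then every $\mathsf{AND}_d\circ\mathsf{MOD}_m\circ\mathsf{MOD}_p\circ\mathsf{AND}_{d'}\circ\Sigma^{c}_{p^\nu}$-circuit of size $\lambda$ can be replaced by an $\mathsf{AND}_d\circ\mathsf{MOD}_m\circ\mathsf{MOD}_p$-circuit of size $O(\lambda^{\nu d'p^3})$ computing the same function.
   Context: Layers are listed from the input layer to the single output gate, multiple wires allowed. $\mathsf{AND}_d$: conjunction of at most $d$ inputs. $\mathsf{MOD}_q$: unbounded fan-in gate summing its Boolean inputs modulo $q$ and outputting 1 iff the sum lies in an accepting set attached to that gate. $\Sigma^{c}_{p^\nu}$: unbounded fan-in gate which on Boolean inputs $c_1,\dots,c_r$ forms $\alpha_1\bar c_1+\dots+\alpha_r\bar c_r+\delta\in\mathbb Z_p^\nu$ (with $\bar c_i=(c_i,\dots,c_i)$, arbitrary $\nu\times\nu$ matrices $\alpha_i$ over $\mathbb Z_p$ and constant $\delta\in\mathbb Z_p^\nu$) and outputs 1 iff this value equals $c$, else 0. -}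

module Defs where

open import Data.Nat using (ℕ; zero; suc; _+_; _*_; _^_; _≤_; NonZero)
open import Data.Nat.DivMod using (_mod_)
open import Data.Nat.Divisibility using (_∣_)
open import Data.Nat.Primality using (Prime)
open import Data.Fin using (Fin; toℕ)
import Data.Fin.Properties as FinP
open import Data.Bool using (Bool; true; false; _∧_; if_then_else_)
open import Data.List using (List; length; map)
open import Data.Nat.ListAction using (sum)
open import Data.Bool.ListAction using (and)
import Data.List as List
open import Data.Product using (_×_; proj₁; proj₂)
open import Relation.Nullary.Decidable using (⌊_⌋)
open import Relation.Nullary using (¬_)

SquareFree : ℕ → Set
SquareFree m = ∀ q → Prime q → ¬ (q * q ∣ m)

bit : Bool → ℕ
bit true  = 1
bit false = 0

evalAND : ∀ {k} → List (Fin k) → (Fin k → Bool) → Bool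
evalAND ws x = and (map x ws)

evalMOD : ∀ {k} (q : ℕ) .{{_ : NonZero q}} → (Fin q → Bool) → List (Fin k) → (Fin k → Bool) → Bool
evalMOD q acc ws x = acc (sum (map (λ w → bit (x w)) ws) mod q)

Mat : ℕ → ℕ → Set
Mat ν p = Fin ν → Fin ν → Fin p

Vecp : ℕ → ℕ → Set
Vecp ν p = Fin ν → Fin p

-- Σ^c_{p^ν} gate: inputs are wires (with multiplicity) each carrying a matrix α_i;
-- computes Σ α_i c̄_i + δ in Z_p^ν (c̄_i = (c_i,…,c_i)) and outputs 1 iff it equals c.
evalΣ : ∀ {k} (ν p : ℕ) .{{_ : NonZero p}} → Vecp ν p →
        List (Fin k × Mat ν p) → Vecp ν p → (Fin k → Bool) → Bool
evalΣ ν p c ws δ x =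
  and (List.tabulate {n = ν} (λ j →
    ⌊ ((sum (map (λ wα → sum (List.tabulate {n = ν} (λ l → toℕ (proj₂ wα j l)))
                          * bit (x (proj₁ wα))) ws) + toℕ (δ j)) mod p)
      FinP.≟ c j ⌋))

-- AND_d ∘ MOD_m ∘ MOD_p circuit on n inputs (layers from input to the single output gate)
record Circ3 (n m p d : ℕ) .{{_ : NonZero m}} .{{_ : NonZero p}} : Set where
  field
    k₁      : ℕ
    and₁    : Fin k₁ → List (Fin n)
    fanin₁  : ∀ i → length (and₁ i) ≤ d
    k₂      : ℕ
    mod₂    : Fin k₂ → List (Fin k₁)
    acc₂    : Fin k₂ → Fin m → Bool
    out     : List (Fin k₂)
    accOut  : Fin p → Bool

module _ {n m p d : ℕ} .{{_ : NonZero m}} .{{_ : NonZero p}} where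
  open Circ3

  size3 : Circ3 n m p d → ℕ
  size3 C = k₁ C + k₂ C + 1

  eval3 : Circ3 n m p d → (Fin n → Bool) → Bool
  eval3 C x =
    let v₁ = λ i → evalAND (and₁ C i) x
        v₂ = λ i → evalMOD m (acc₂ C i) (mod₂ C i) v₁
    in evalMOD p (accOut C) (out C) v₂

record Circ5 (n m p ν d d' : ℕ) .{{_ : NonZero m}} .{{_ : NonZero p}} : Set where
  field
    k₁      : ℕ
    and₁    : Fin k₁ → List (Fin n)
    fanin₁  : ∀ i → length (and₁ i) ≤ d
    k₂      : ℕ
    mod₂    : Fin k₂ → List (Fin k₁)
    acc₂    : Fin k₂ → Fin m → Bool
    k₃      : ℕ
    mod₃    : Fin k₃ → List (Fin k₂)
    acc₃    : Fin k₃ → Fin p → Bool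
    k₄      : ℕ
    and₄    : Fin k₄ → List (Fin k₃)
    fanin₄  : ∀ i → length (and₄ i) ≤ d'
    out     : List (Fin k₄ × Mat ν p)
    δ       : Vecp ν p

module _ {n m p ν d d' : ℕ} .{{_ : NonZero m}} .{{_ : NonZero p}} where
  open Circ5

  size5 : Circ5 n m p ν d d' → ℕ
  size5 C = k₁ C + k₂ C + k₃ C + k₄ C + 1

  eval5 : Vecp ν p → Circ5 n m p ν d d' → (Fin n → Bool) → Bool
  eval5 c C x =
    let v₁ = λ i → evalAND (and₁ C i) x
        v₂ = λ i → evalMOD m (acc₂ C i) (mod₂ C i) v₁
        v₃ = λ i → evalMOD p (acc₃ C i) (mod₃ C i) v₂
        v₄ = λ i → evalAND (and₄ C i) v₃
    in evalΣ ν p c (out C) (δ C) v₄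

-- Everything is computed modulo p. A MOD_p gate tests the residue of a sum s of outputs y_j
-- of MOD_m gates, and its test s ≡ a is the Lagrange polynomial ∏_{b ≠ a} (s − b) / (a − b);
-- treating the AND_{d'} gates and the Σ^c gate the same way writes the output of the circuit
-- as a polynomial of degree D = ν p d' p ≤ ν d' p³ in the y_j. Since m is square-free and
-- prime to p, a product [m ∣ x] [m ∣ z] of divisibility tests is, modulo p, a sum of tests
-- [m ∣ α x + β z + γ]: for a prime q, q [q ∣ x] [q ∣ z] ≡ ∑_{b < q} [q ∣ x + b z] + [q ∣ z] − 1,
-- and the prime factors of m are combined by the Chinese remainder theorem. A MOD_m gate is a
-- sum of such tests over the residues it accepts, so every monomial in the y_j is a sum of at
-- most C^D MOD_m gates over the same AND layer, with C independent of the circuit, and the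
-- polynomial becomes a single MOD_p gate over at most (k + 1)^D p C^D of them.

module Submission where

open import Defs
open import Data.Bool using (Bool; true; false; if_then_else_; _∧_)
open import Data.Bool.ListAction using (and)
open import Data.Fin using (Fin; zero; suc; toℕ)
open import Data.Fin.Properties using (toℕ<n; toℕ-injective; toℕ-fromℕ<) renaming (_≟_ to _≟ᶠ_)
open import Data.List using (List; []; _∷_; _++_; map; concat; concatMap; replicate; length; tabulate; allFin; lookup)
open import Data.List.Properties
  using (map-++; map-∘; map-cong; map-tabulate; tabulate-cong; tabulate-lookup; length-++; length-map; length-tabulate)
open import Data.List.Relation.Unary.All using (All; []; _∷_)
import Data.List.Relation.Unary.All.Properties as All
open import Data.List.Relation.Unary.Any using (Any; here; there)
import Data.List.Relation.Unary.Any.Properties as Any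
open import Data.Nat
open import Data.Nat.Coprimality using (Coprime; coprime-divisor; coprime-Bézout)
import Data.Nat.Coprimality as Coprime
open import Data.Nat.DivMod
open import Data.Nat.Divisibility
open import Data.Nat.GCD using (module Bézout)
open import Data.Nat.ListAction using (sum; product)
open import Data.Nat.ListAction.Properties using (sum-++)
open import Data.Nat.Primality using (Prime; prime⇒irreducible; prime⇒nonZero; prime⇒nonTrivial; euclidsLemma)
open import Data.Nat.Primality.Factorisation using (PrimeFactorisation; factorise)
open import Data.Nat.Properties
open import Algebra.Properties.CommutativeSemigroup +-commutativeSemigroup using ()
  renaming (interchange to +-interchange)
open import Algebra.Properties.CommutativeSemigroup *-commutativeSemigroup using ()
  renaming (interchange to *-interchange)
open import Data.Nat.Tactic.RingSolver using (solve-∀)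
open import Data.Product using (Σ; ∃; _×_; _,_; proj₁; proj₂)
open import Data.Sum using (inj₁; inj₂; [_,_]′)
open import Data.Vec using (Vec; []; _∷_; take; drop) renaming (_++_ to _++ᵛ_)
open import Data.Vec.Properties using (take++drop≡id; ++-injectiveˡ; ++-injectiveʳ)
open import Function using (_∘_; id)
open import Function.Bundles using (_⇔_; mk⇔)
open import Level using (0ℓ)
open import Relation.Binary.Bundles using (Setoid)
import Relation.Binary.Construct.On as On
open import Relation.Binary.PropositionalEquality
import Relation.Binary.Reasoning.Setoid as SetoidReasoning
open import Relation.Nullary using (¬_; Dec; yes; no; does; contradiction)
open import Relation.Nullary.Decidable using (⌊_⌋; dec-true; dec-false; isYes≗does; does-⇔; ⌊⌋-map′)

private variable A B : Set

-- Sums over lists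

∑ : List A → (A → ℕ) → ℕ
∑ xs f = sum (map f xs)

infix 5 ∑
syntax ∑ xs (λ x → e) = ∑[ x ∈ xs ] e

∑-++ : ∀ xs ys (f : A → ℕ) → ∑ (xs ++ ys) f ≡ ∑ xs f + ∑ ys f
∑-++ xs ys f = trans (cong sum (map-++ f xs ys)) (sum-++ (map f xs) (map f ys))

∑-map : ∀ (g : A → B) xs (f : B → ℕ) → ∑ (map g xs) f ≡ ∑ xs (f ∘ g)
∑-map g xs f = cong sum (sym (map-∘ xs))

∑-cong : ∀ xs {f g : A → ℕ} → (∀ x → f x ≡ g x) → ∑ xs f ≡ ∑ xs g
∑-cong xs f≗g = cong sum (map-cong f≗g xs)

∑-concatMap : ∀ (g : A → List B) xs (f : B → ℕ) → ∑ (concatMap g xs) f ≡ ∑[ x ∈ xs ] ∑ (g x) f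
∑-concatMap g []       f = refl
∑-concatMap g (x ∷ xs) f = trans (∑-++ (g x) (concatMap g xs) f) (cong (∑ (g x) f +_) (∑-concatMap g xs f))

∑-const : ∀ (xs : List A) c → ∑ xs (λ _ → c) ≡ length xs * c
∑-const []       c = refl
∑-const (x ∷ xs) c = cong (c +_) (∑-const xs c)

∑-zero : ∀ (xs : List A) → ∑ xs (λ _ → 0) ≡ 0
∑-zero xs = trans (∑-const xs 0) (*-zeroʳ (length xs))

∑-+ : ∀ xs (f g : A → ℕ) → ∑[ x ∈ xs ] (f x + g x) ≡ ∑ xs f + ∑ xs g
∑-+ []       f g = refl
∑-+ (x ∷ xs) f g = trans (cong (f x + g x +_) (∑-+ xs f g)) (+-interchange (f x) (g x) _ _)

*-distribˡ-∑ : ∀ c xs (f : A → ℕ) → c * ∑ xs f ≡ ∑[ x ∈ xs ] c * f x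
*-distribˡ-∑ c []       f = *-zeroʳ c
*-distribˡ-∑ c (x ∷ xs) f = trans (*-distribˡ-+ c (f x) (∑ xs f)) (cong (c * f x +_) (*-distribˡ-∑ c xs f))

*-distribʳ-∑ : ∀ c xs (f : A → ℕ) → ∑ xs f * c ≡ ∑[ x ∈ xs ] f x * c
*-distribʳ-∑ c xs f = trans (*-comm (∑ xs f) c) (trans (*-distribˡ-∑ c xs f) (∑-cong xs λ x → *-comm c (f x)))

∑-swap : ∀ xs ys (F : A → B → ℕ) → ∑[ x ∈ xs ] ∑[ y ∈ ys ] F x y ≡ ∑[ y ∈ ys ] ∑[ x ∈ xs ] F x y
∑-swap []       ys F = sym (∑-zero ys)
∑-swap (x ∷ xs) ys F = trans (cong (∑ ys (F x) +_) (∑-swap xs ys F)) (sym (∑-+ ys (F x) _))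

∑-*-∑ : ∀ xs ys (f : A → ℕ) (g : B → ℕ) → ∑ xs f * ∑ ys g ≡ ∑[ x ∈ xs ] ∑[ y ∈ ys ] f x * g y
∑-*-∑ xs ys f g = begin
  ∑ xs f * ∑ ys g                 ≡⟨ *-comm (∑ xs f) (∑ ys g) ⟩
  ∑ ys g * ∑ xs f                 ≡⟨ *-distribˡ-∑ (∑ ys g) xs f ⟩
  ∑[ x ∈ xs ] ∑ ys g * f x        ≡⟨ ∑-cong xs (λ x → trans (*-comm (∑ ys g) (f x))
                                                          (*-distribˡ-∑ (f x) ys g)) ⟩
  ∑[ x ∈ xs ] ∑[ y ∈ ys ] f x * g y ∎
  where open ≡-Reasoning

∑-mono-≤ : ∀ xs {f g : A → ℕ} → (∀ x → f x ≤ g x) → ∑ xs f ≤ ∑ xs g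
∑-mono-≤ []       f≤g = z≤n
∑-mono-≤ (x ∷ xs) f≤g = +-mono-≤ (f≤g x) (∑-mono-≤ xs f≤g)

∑-replicate : ∀ k (x : A) (f : A → ℕ) → ∑ (replicate k x) f ≡ k * f x
∑-replicate zero    x f = refl
∑-replicate (suc k) x f = cong (f x +_) (∑-replicate k x f)

copies : ℕ → List A → List A
copies k xs = concat (replicate k xs)

∑-copies : ∀ k xs (f : A → ℕ) → ∑ (copies k xs) f ≡ k * ∑ xs f
∑-copies zero    xs f = refl
∑-copies (suc k) xs f = trans (∑-++ xs (copies k xs) f) (cong (∑ xs f +_) (∑-copies k xs f))

length-concatMap : ∀ (g : A → List B) xs → length (concatMap g xs) ≡ ∑[ x ∈ xs ] length (g x)
length-concatMap g []       = refl
length-concatMap g (x ∷ xs) = trans (length-++ (g x)) (cong (length (g x) +_) (length-concatMap g xs))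

length-copies : ∀ k (xs : List A) → length (copies k xs) ≡ k * length xs
length-copies zero    xs = refl
length-copies (suc k) xs = trans (length-++ xs) (cong (length xs +_) (length-copies k xs))

∑-allFin-lookup : ∀ (xs : List A) (f : A → ℕ) → ∑[ i ∈ allFin (length xs) ] f (lookup xs i) ≡ ∑ xs f
∑-allFin-lookup xs f = begin
  sum (map (f ∘ lookup xs) (allFin (length xs))) ≡⟨ cong sum (map-tabulate id (f ∘ lookup xs)) ⟩
  sum (tabulate (f ∘ lookup xs))               ≡⟨ cong sum (sym (map-tabulate (lookup xs) f)) ⟩
  sum (map f (tabulate (lookup xs)))           ≡⟨ cong (sum ∘ map f) (tabulate-lookup xs) ⟩
  ∑ xs f                                       ∎
  where open ≡-Reasoning

length-allFin : ∀ n → length (allFin n) ≡ n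
length-allFin n = length-tabulate {n = n} id

∑-allFin-suc : ∀ n (f : Fin (suc n) → ℕ) → ∑ (allFin (suc n)) f ≡ f zero + (∑[ i ∈ allFin n ] f (suc i))
∑-allFin-suc n f = cong (f zero +_) (trans (cong (sum ∘ map f) (sym (map-tabulate id suc))) (∑-map suc (allFin n) f))

𝟙[_≡_] : ∀ {n} → Fin n → Fin n → ℕ
𝟙[ i ≡ j ] = bit ⌊ i ≟ᶠ j ⌋

⌊≟⌋-true : ∀ {n} {i j : Fin n} → i ≡ j → ⌊ i ≟ᶠ j ⌋ ≡ true
⌊≟⌋-true {i = i} {j} i≡j = trans (isYes≗does (i ≟ᶠ j)) (dec-true (i ≟ᶠ j) i≡j)

⌊≟⌋-false : ∀ {n} {i j : Fin n} → i ≢ j → ⌊ i ≟ᶠ j ⌋ ≡ false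
⌊≟⌋-false {i = i} {j} i≢j = trans (isYes≗does (i ≟ᶠ j)) (dec-false (i ≟ᶠ j) i≢j)

𝟙-≡ : ∀ {n} {i j : Fin n} → i ≡ j → 𝟙[ i ≡ j ] ≡ 1
𝟙-≡ i≡j = cong bit (⌊≟⌋-true i≡j)

𝟙-≢ : ∀ {n} {i j : Fin n} → i ≢ j → 𝟙[ i ≡ j ] ≡ 0
𝟙-≢ i≢j = cong bit (⌊≟⌋-false i≢j)

𝟙-suc : ∀ {n} (i j : Fin n) → 𝟙[ suc i ≡ suc j ] ≡ 𝟙[ i ≡ j ]
𝟙-suc i j = cong bit (⌊⌋-map′ _ _ (i ≟ᶠ j))

∑-𝟙 : ∀ {n} (a : Fin n) (g : Fin n → ℕ) → ∑[ i ∈ allFin n ] 𝟙[ a ≡ i ] * g i ≡ g a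
∑-𝟙 {suc n} zero g = begin
  ∑[ i ∈ allFin (suc n) ] 𝟙[ zero ≡ i ] * g i ≡⟨ ∑-allFin-suc n _ ⟩
  g zero + 0 + (∑[ i ∈ allFin n ] 0)          ≡⟨ cong₂ _+_ (+-identityʳ (g zero)) (∑-zero (allFin n)) ⟩
  g zero + 0                                  ≡⟨ +-identityʳ (g zero) ⟩
  g zero                                      ∎
  where open ≡-Reasoning
∑-𝟙 {suc n} (suc a) g = begin
  ∑[ i ∈ allFin (suc n) ] 𝟙[ suc a ≡ i ] * g i      ≡⟨ ∑-allFin-suc n (λ i → 𝟙[ suc a ≡ i ] * g i) ⟩
  ∑[ i ∈ allFin n ] 𝟙[ suc a ≡ suc i ] * g (suc i)
    ≡⟨ ∑-cong (allFin n) (λ i → cong (_* g (suc i)) (𝟙-suc a i)) ⟩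
  ∑[ i ∈ allFin n ] 𝟙[ a ≡ i ] * g (suc i)         ≡⟨ ∑-𝟙 a (g ∘ suc) ⟩
  g (suc a)                                        ∎
  where open ≡-Reasoning

bit-∧ : ∀ a b → bit (a ∧ b) ≡ bit a * bit b
bit-∧ true  b = sym (+-identityʳ (bit b))
bit-∧ false b = refl

bit-and : ∀ bs → bit (and bs) ≡ product (map bit bs)
bit-and []       = refl
bit-and (b ∷ bs) = trans (bit-∧ b (and bs)) (cong (bit b *_) (bit-and bs))

-- Congruence modulo N

module Modular (N : ℕ) .{{_ : NonZero N}} where

  infix 4 _≈_
  _≈_ : ℕ → ℕ → Set
  a ≈ b = a % N ≡ b % N

  ≈-setoid : Setoid 0ℓ 0ℓ
  ≈-setoid = On.setoid (setoid ℕ) (_% N)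

  module ≈-Reasoning = SetoidReasoning ≈-setoid

  %-≈ : ∀ a → a % N ≈ a
  %-≈ a = m%n%n≡m%n a N

  toℕ-mod-≈ : ∀ a → toℕ (a mod N) ≈ a
  toℕ-mod-≈ a = trans (cong (_% N) (toℕ-fromℕ< (m%n<n a N))) (%-≈ a)

  +-modulus-≈ : ∀ a → a + N ≈ a
  +-modulus-≈ a = [m+n]%n≡m%n a N

  multiple-≈0 : ∀ k → k * N ≈ 0
  multiple-≈0 k = trans (m*n%n≡0 k N) (sym (m*n%n≡0 0 N))

  +-multiple-≈ : ∀ a k → a + k * N ≈ a
  +-multiple-≈ a k = [m+kn]%n≡m%n a k N

  ≈-+ : ∀ {a b c d} → a ≈ b → c ≈ d → a + c ≈ b + d
  ≈-+ {a} {b} {c} {d} a≈b c≈d = begin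
    (a + c) % N             ≡⟨ %-distribˡ-+ a c N ⟩
    (a % N + c % N) % N     ≡⟨ cong₂ (λ x y → (x + y) % N) a≈b c≈d ⟩
    (b % N + d % N) % N     ≡⟨ %-distribˡ-+ b d N ⟨
    (b + d) % N             ∎
    where open ≡-Reasoning

  ≈-* : ∀ {a b c d} → a ≈ b → c ≈ d → a * c ≈ b * d
  ≈-* {a} {b} {c} {d} a≈b c≈d = begin
    (a * c) % N             ≡⟨ %-distribˡ-* a c N ⟩
    (a % N * (c % N)) % N   ≡⟨ cong₂ (λ x y → (x * y) % N) a≈b c≈d ⟩
    (b % N * (d % N)) % N   ≡⟨ %-distribˡ-* b d N ⟨
    (b * d) % N             ∎
    where open ≡-Reasoning

  ≈-*ˡ : ∀ c {a b} → a ≈ b → c * a ≈ c * b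
  ≈-*ˡ c = ≈-* {c} refl

  ≈-∑ : ∀ xs {f g : A → ℕ} → (∀ x → f x ≈ g x) → ∑ xs f ≈ ∑ xs g
  ≈-∑ []       f≈g = refl
  ≈-∑ (x ∷ xs) f≈g = ≈-+ (f≈g x) (≈-∑ xs f≈g)

  ≈-product : ∀ xs {f g : A → ℕ} → (∀ x → f x ≈ g x) → product (map f xs) ≈ product (map g xs)
  ≈-product []       f≈g = refl
  ≈-product (x ∷ xs) f≈g = ≈-* (f≈g x) (≈-product xs f≈g)

  product-≈1 : ∀ {xs} → All (_≈ 1) xs → product xs ≈ 1
  product-≈1 []                = refl
  product-≈1 (x≈1 ∷ xs≈1) = ≈-* x≈1 (product-≈1 xs≈1)

  product-≈0 : ∀ {xs} → Any (_≈ 0) xs → product xs ≈ 0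
  product-≈0 {x ∷ xs} (here x≈0)     = ≈-* {x} {0} {product xs} x≈0 refl
  product-≈0 {x ∷ xs} (there xs≈0) = trans (≈-*ˡ x (product-≈0 xs≈0)) (cong (_% N) (*-zeroʳ x))

-- Divisibility indicators

⟦_∣_⟧ : ℕ → ℕ → ℕ
⟦ d ∣ v ⟧ = bit (does (d ∣? v))

⟦∣⟧≡1 : ∀ {d v} → d ∣ v → ⟦ d ∣ v ⟧ ≡ 1
⟦∣⟧≡1 {d} {v} d∣v = cong bit (dec-true (d ∣? v) d∣v)

⟦∣⟧≡0 : ∀ {d v} → ¬ d ∣ v → ⟦ d ∣ v ⟧ ≡ 0
⟦∣⟧≡0 {d} {v} d∤v = cong bit (dec-false (d ∣? v) d∤v)

∣-resp-% : ∀ d .{{_ : NonZero d}} {a b} → a % d ≡ b % d → d ∣ a → d ∣ b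
∣-resp-% d {a} {b} a≈b d∣a = m%n≡0⇒n∣m b d (trans (sym a≈b) (n∣m⇒m%n≡0 a d d∣a))

⟦∣⟧-cong : ∀ d .{{_ : NonZero d}} {a b} → a % d ≡ b % d → ⟦ d ∣ a ⟧ ≡ ⟦ d ∣ b ⟧
⟦∣⟧-cong d {a} {b} a≈b =
  cong bit (does-⇔ (mk⇔ (∣-resp-% d a≈b) (∣-resp-% d (sym a≈b))) (d ∣? a) (d ∣? b))

coprime-∣⇒*-∣ : ∀ {q r u} → Coprime q r → q ∣ u → r ∣ u → q * r ∣ u
coprime-∣⇒*-∣ {q} {r} q⊥r q∣kr (divides k refl) with coprime-divisor q⊥r (subst (q ∣_) (*-comm k r) q∣kr)
... | divides j refl = divides j (*-assoc j q r)

⟦∣⟧-*-coprime : ∀ {q r} → Coprime q r → ∀ v → ⟦ q * r ∣ v ⟧ ≡ ⟦ q ∣ v ⟧ * ⟦ r ∣ v ⟧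
⟦∣⟧-*-coprime {q} {r} q⊥r v with q ∣? v | r ∣? v
... | yes q∣v | yes r∣v = ⟦∣⟧≡1 (coprime-∣⇒*-∣ q⊥r q∣v r∣v)
... | no  q∤v | _       = ⟦∣⟧≡0 (q∤v ∘ m*n∣⇒m∣ q r)
... | yes _   | no  r∤v = ⟦∣⟧≡0 (r∤v ∘ m*n∣⇒n∣ q r)

⟦∣⟧-coprime-+ : ∀ {q r} → Coprime q r → ∀ u v → ⟦ q ∣ r * u + q * v ⟧ ≡ ⟦ q ∣ u ⟧
⟦∣⟧-coprime-+ {q} {r} q⊥r u v = cong bit (does-⇔ (mk⇔ to from) (q ∣? _) (q ∣? u))
  where
  to : q ∣ r * u + q * v → q ∣ u
  to q∣w = coprime-divisor q⊥r (∣m+n∣m⇒∣n (subst (q ∣_) (+-comm (r * u) (q * v)) q∣w) (m∣m*n v))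
  from : q ∣ u → q ∣ r * u + q * v
  from q∣u = ∣m∣n⇒∣m+n (∣n⇒∣m*n r q∣u) (m∣m*n v)

⟦∣⟧-crt : ∀ {q r} → Coprime q r → ∀ u v → ⟦ q * r ∣ r * u + q * v ⟧ ≡ ⟦ q ∣ u ⟧ * ⟦ r ∣ v ⟧
⟦∣⟧-crt {q} {r} q⊥r u v = trans (⟦∣⟧-*-coprime q⊥r _)
  (cong₂ _*_ (⟦∣⟧-coprime-+ q⊥r u v)
             (trans (cong ⟦ r ∣_⟧ (+-comm (r * u) (q * v))) (⟦∣⟧-coprime-+ (Coprime.sym q⊥r) v u)))

-- Subtraction of residues is written a + (N ∸ b), so that no truncation occurs.
module _ {N : ℕ} .{{_ : NonZero N}} where

  ∣-difference⇒≡ : ∀ (a b : Fin N) → N ∣ toℕ a + (N ∸ toℕ b) → a ≡ b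
  ∣-difference⇒≡ a b N∣d = toℕ-injective (begin
    toℕ a                           ≡⟨ m<n⇒m%n≡m (toℕ<n a) ⟨
    toℕ a % N                       ≡⟨ [m+n]%n≡m%n (toℕ a) N ⟨
    (toℕ a + N) % N                 ≡⟨ cong (λ t → (toℕ a + t) % N) (m∸n+n≡m (<⇒≤ (toℕ<n b))) ⟨
    (toℕ a + (N ∸ toℕ b + toℕ b)) % N ≡⟨ cong (_% N) (+-assoc (toℕ a) _ (toℕ b)) ⟨
    (toℕ a + (N ∸ toℕ b) + toℕ b) % N ≡⟨ %-remove-+ˡ (toℕ b) N∣d ⟩
    toℕ b % N                       ≡⟨ m<n⇒m%n≡m (toℕ<n b) ⟩
    toℕ b                           ∎)
    where open ≡-Reasoning

  ∣-difference⇔≡ : ∀ (a b : Fin N) → N ∣ toℕ a + (N ∸ toℕ b) ⇔ a ≡ b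
  ∣-difference⇔≡ a b = mk⇔ (∣-difference⇒≡ a b)
                             λ { refl → ∣-reflexive (sym (m+[n∸m]≡n (<⇒≤ (toℕ<n a)))) }

  ⟦∣⟧-residue : ∀ u (a : Fin N) → ⟦ N ∣ u + (N ∸ toℕ a) ⟧ ≡ 𝟙[ u mod N ≡ a ]
  ⟦∣⟧-residue u a = begin
    ⟦ N ∣ u + (N ∸ toℕ a) ⟧
      ≡⟨ ⟦∣⟧-cong N (Modular.≈-+ N (sym (Modular.toℕ-mod-≈ N u)) refl) ⟩
    ⟦ N ∣ toℕ (u mod N) + (N ∸ toℕ a) ⟧
      ≡⟨ cong bit (does-⇔ (∣-difference⇔≡ _ a) (N ∣? _) (u mod N ≟ᶠ a)) ⟩
    bit (does (u mod N ≟ᶠ a))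
      ≡⟨ cong bit (isYes≗does _) ⟨
    𝟙[ u mod N ≡ a ]
      ∎
    where open ≡-Reasoning

-- Linear congruences modulo a prime

∣∧<⇒≡0 : ∀ {q d} → q ∣ d → d < q → d ≡ 0
∣∧<⇒≡0 {d = zero}  _   _   = refl
∣∧<⇒≡0 {d = suc _} q∣d d<q = contradiction q∣d (>⇒∤ d<q)

prime∤⇒coprime : ∀ {q a} → Prime q → ¬ q ∣ a → Coprime q a
prime∤⇒coprime q-prime q∤a (i∣q , i∣a) with prime⇒irreducible q-prime i∣q
... | inj₁ i≡1 = i≡1
... | inj₂ refl = contradiction i∣a q∤a

module _ {q : ℕ} .{{_ : NonZero q}} (q-prime : Prime q) where
  open Modular q
  open ≈-Reasoning

  private
    inverse : ∀ {a} → ¬ q ∣ a → ∃ λ i → a * i ≈ 1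
    inverse {a} q∤a with coprime-Bézout (prime∤⇒coprime q-prime q∤a)
    ... | Bézout.-+ x y eq = y , (begin
      a * y     ≡⟨ trans (*-comm a y) (sym eq) ⟩
      1 + x * q ≈⟨ +-multiple-≈ 1 x ⟩
      1         ∎)
    ... | Bézout.+- x y eq = y * pred q , (begin
      a * (y * pred q)                    ≈⟨ +-multiple-≈ _ 1 ⟨
      a * (y * pred q) + 1 * q            ≡⟨ cong (λ t → a * (y * pred q) + 1 * t) (sym (suc-pred q)) ⟩
      a * (y * pred q) + 1 * suc (pred q) ≡⟨ expand a y (pred q) ⟩
      (1 + y * a) * pred q + 1            ≡⟨ cong (λ t → t * pred q + 1) eq ⟩
      x * q * pred q + 1                  ≡⟨ regroup x q (pred q) ⟩
      1 + x * pred q * q                  ≈⟨ +-multiple-≈ 1 (x * pred q) ⟩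
      1                                   ∎)
      where
      expand : ∀ a y n → a * (y * n) + 1 * suc n ≡ (1 + y * a) * n + 1
      expand = solve-∀
      regroup : ∀ x q n → x * q * n + 1 ≡ 1 + x * n * q
      regroup = solve-∀

  -- The junk value 0 is returned for multiples of q.
  inv : ℕ → ℕ
  inv a with q ∣? a
  ... | yes _   = 0
  ... | no  q∤a = proj₁ (inverse q∤a)

  *-inv : ∀ {a} → ¬ q ∣ a → a * inv a ≈ 1
  *-inv {a} q∤a with q ∣? a
  ... | yes q∣a = contradiction q∣a q∤a
  ... | no  q∤a = proj₂ (inverse q∤a)

  private
    ∣-linear-injective-≤ : ∀ {x z b b'} → ¬ q ∣ z → b ≤ b' → b' < q →
                           q ∣ x + b * z → q ∣ x + b' * z → b ≡ b'
    ∣-linear-injective-≤ {x} {z} {b} {b'} q∤z b≤b' b'<q q∣xbz q∣xb'z =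
      sym (trans (sym (m+[n∸m]≡n b≤b')) (trans (cong (b +_) d≡0) (+-identityʳ b)))
      where
      d : ℕ
      d = b' ∸ b
      split : ∀ x b d z → x + (b + d) * z ≡ x + b * z + d * z
      split = solve-∀
      x+b'z≡x+bz+dz : x + b' * z ≡ x + b * z + d * z
      x+b'z≡x+bz+dz = trans (cong (λ t → x + t * z) (sym (m+[n∸m]≡n b≤b'))) (split x b d z)
      q∣dz : q ∣ d * z
      q∣dz = ∣m+n∣m⇒∣n (subst (q ∣_) x+b'z≡x+bz+dz q∣xb'z) q∣xbz
      d≡0 : d ≡ 0
      d≡0 = [ (λ q∣d → ∣∧<⇒≡0 q∣d (≤-<-trans (m∸n≤m b' b) b'<q))
            , (λ q∣z → contradiction q∣z q∤z)
            ]′ (euclidsLemma d z q-prime q∣dz)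

  ∣-linear-injective : ∀ {x z b b'} → ¬ q ∣ z → b < q → b' < q →
                       q ∣ x + b * z → q ∣ x + b' * z → b ≡ b'
  ∣-linear-injective q∤z b<q b'<q q∣xbz q∣xb'z with ≤-total _ _
  ... | inj₁ b≤b' = ∣-linear-injective-≤ q∤z b≤b' b'<q q∣xbz q∣xb'z
  ... | inj₂ b'≤b = sym (∣-linear-injective-≤ q∤z b'≤b b<q q∣xb'z q∣xbz)

  ∣-linear-root : ∀ x {z} → ¬ q ∣ z → Σ (Fin q) λ b₀ → q ∣ x + toℕ b₀ * z
  ∣-linear-root x {z} q∤z = b₀ , m%n≡0⇒n∣m _ q (trans root (n%n≡0 q))
    where
    i c : ℕ
    i = inv z
    c = q ∸ x % q
    b₀ : Fin q
    b₀ = (c * i) mod q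
    root : x + toℕ b₀ * z ≈ q
    root = begin
      x + toℕ b₀ * z  ≈⟨ ≈-+ {x} refl (≈-* (toℕ-mod-≈ (c * i)) refl) ⟩
      x + c * i * z   ≡⟨ cong (x +_) (trans (*-assoc c i z) (cong (c *_) (*-comm i z))) ⟩
      x + c * (z * i) ≈⟨ ≈-+ {x} refl (≈-*ˡ c (*-inv q∤z)) ⟩
      x + c * 1       ≈⟨ ≈-+ (%-≈ x) refl ⟨
      x % q + c * 1   ≡⟨ trans (cong (x % q +_) (*-identityʳ c)) (m+[n∸m]≡n (m%n≤n x q)) ⟩
      q               ∎

  ⟦∣⟧-linear : ∀ x {z} (q∤z : ¬ q ∣ z) b →
               ⟦ q ∣ x + toℕ b * z ⟧ ≡ 𝟙[ proj₁ (∣-linear-root x q∤z) ≡ b ]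
  ⟦∣⟧-linear x {z} q∤z b = cong bit (trans (does-⇔ (mk⇔ to from) (q ∣? _) (b₀ ≟ᶠ b)) (sym (isYes≗does _)))
    where
    b₀ : Fin q
    b₀ = proj₁ (∣-linear-root x q∤z)
    to : q ∣ x + toℕ b * z → b₀ ≡ b
    to q∣xbz = toℕ-injective
      (∣-linear-injective q∤z (toℕ<n b₀) (toℕ<n b) (proj₂ (∣-linear-root x q∤z)) q∣xbz)
    from : b₀ ≡ b → q ∣ x + toℕ b * z
    from refl = proj₂ (∣-linear-root x q∤z)

  ∑-⟦∣⟧-linear : ∀ x {z} → ¬ q ∣ z → ∑[ b ∈ allFin q ] ⟦ q ∣ x + toℕ b * z ⟧ ≡ 1
  ∑-⟦∣⟧-linear x q∤z = trans (∑-cong (allFin q) (λ b → trans (⟦∣⟧-linear x q∤z b) (sym (*-identityʳ _))))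
                             (∑-𝟙 (proj₁ (∣-linear-root x q∤z)) (λ _ → 1))

∑-⟦∣⟧-linear-∣ : ∀ {q} .{{_ : NonZero q}} x {z} → q ∣ z →
                 ∑[ b ∈ allFin q ] ⟦ q ∣ x + toℕ b * z ⟧ ≡ q * ⟦ q ∣ x ⟧
∑-⟦∣⟧-linear-∣ {q} x {z} q∣z = begin
  ∑[ b ∈ allFin q ] ⟦ q ∣ x + toℕ b * z ⟧
    ≡⟨ ∑-cong (allFin q) (λ b → ⟦∣⟧-cong q (%-remove-+ʳ x (∣n⇒∣m*n (toℕ b) q∣z))) ⟩
  ∑[ b ∈ allFin q ] ⟦ q ∣ x ⟧             ≡⟨ ∑-const (allFin q) _ ⟩
  length (allFin q) * ⟦ q ∣ x ⟧           ≡⟨ cong (_* ⟦ q ∣ x ⟧) (length-allFin q) ⟩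
  q * ⟦ q ∣ x ⟧                           ∎
  where open ≡-Reasoning

-- Products of divisibility indicators modulo p

Affine : Set
Affine = ℕ × ℕ × ℕ

affine : Affine → ℕ → ℕ → ℕ
affine (a , b , c) x z = a * x + b * z + c

module ProductFormulas (p : ℕ) .{{_ : NonZero p}} where
  open Modular p

  IsProductFormula : ℕ → List Affine → Set
  IsProductFormula m L = ∀ x z → ∑[ T ∈ L ] ⟦ m ∣ affine T x z ⟧ ≈ ⟦ m ∣ x ⟧ * ⟦ m ∣ z ⟧

  productFormula-1 : IsProductFormula 1 ((0 , 0 , 0) ∷ [])
  productFormula-1 x z = cong (_% p) (sym (cong₂ _*_ (⟦∣⟧≡1 (1∣ x)) (⟦∣⟧≡1 (1∣ z))))

  crt : ℕ → ℕ → Affine → Affine → Affine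
  crt q r (a₁ , b₁ , c₁) (a₂ , b₂ , c₂) = r * a₁ + q * a₂ , r * b₁ + q * b₂ , r * c₁ + q * c₂

  affine-crt : ∀ q r T₁ T₂ x z → affine (crt q r T₁ T₂) x z ≡ r * affine T₁ x z + q * affine T₂ x z
  affine-crt q r (a₁ , b₁ , c₁) (a₂ , b₂ , c₂) x z = distrib q r a₁ b₁ c₁ a₂ b₂ c₂ x z
    where
    distrib : ∀ q r a₁ b₁ c₁ a₂ b₂ c₂ x z →
      (r * a₁ + q * a₂) * x + (r * b₁ + q * b₂) * z + (r * c₁ + q * c₂)
        ≡ r * (a₁ * x + b₁ * z + c₁) + q * (a₂ * x + b₂ * z + c₂)
    distrib = solve-∀

  crtTerms : ℕ → ℕ → List Affine → List Affine → List Affine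
  crtTerms q r A B = concatMap (λ T₁ → map (crt q r T₁) B) A

  productFormula-coprime : ∀ {q r} A B → Coprime q r → IsProductFormula q A → IsProductFormula r B →
                           IsProductFormula (q * r) (crtTerms q r A B)
  productFormula-coprime {q} {r} A B q⊥r A-ok B-ok x z = begin
    ∑[ T ∈ crtTerms q r A B ] ⟦ q * r ∣ affine T x z ⟧
      ≡⟨ ∑-concatMap _ A _ ⟩
    ∑[ T₁ ∈ A ] ∑ (map (crt q r T₁) B) (λ T → ⟦ q * r ∣ affine T x z ⟧)
      ≡⟨ ∑-cong A (λ T₁ → trans (∑-map (crt q r T₁) B _) (∑-cong B (λ T₂ →
           trans (cong ⟦ q * r ∣_⟧ (affine-crt q r T₁ T₂ x z)) (⟦∣⟧-crt q⊥r _ _)))) ⟩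
    ∑[ T₁ ∈ A ] ∑[ T₂ ∈ B ] ⟦ q ∣ affine T₁ x z ⟧ * ⟦ r ∣ affine T₂ x z ⟧
      ≡⟨ ∑-*-∑ A B _ _ ⟨
    (∑[ T₁ ∈ A ] ⟦ q ∣ affine T₁ x z ⟧) * (∑[ T₂ ∈ B ] ⟦ r ∣ affine T₂ x z ⟧)
      ≈⟨ ≈-* (A-ok x z) (B-ok x z) ⟩
    (⟦ q ∣ x ⟧ * ⟦ q ∣ z ⟧) * (⟦ r ∣ x ⟧ * ⟦ r ∣ z ⟧)
      ≡⟨ *-interchange ⟦ q ∣ x ⟧ _ _ _ ⟩
    (⟦ q ∣ x ⟧ * ⟦ r ∣ x ⟧) * (⟦ q ∣ z ⟧ * ⟦ r ∣ z ⟧)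
      ≡⟨ cong₂ _*_ (⟦∣⟧-*-coprime q⊥r x) (⟦∣⟧-*-coprime q⊥r z) ⟨
    ⟦ q * r ∣ x ⟧ * ⟦ q * r ∣ z ⟧
      ∎
    where open ≈-Reasoning

  module _ {q : ℕ} .{{_ : NonZero q}} (q-prime : Prime q) where

    -- ∑_b [q ∣ x + b z] is q [q ∣ x] if q ∣ z and 1 otherwise; the remaining terms add
    -- [q ∣ z] + (p − 1), so that the total is q [q ∣ x] [q ∣ z] modulo p in both cases.
    primeTerms : List Affine
    primeTerms = map (λ b → 1 , toℕ b , 0) (allFin q) ++ (0 , 1 , 0) ∷ replicate (pred p) (0 , 0 , 0)

    ∑-primeTerms : ∀ x z → ∑[ T ∈ primeTerms ] ⟦ q ∣ affine T x z ⟧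
                           ≡ (∑[ b ∈ allFin q ] ⟦ q ∣ x + toℕ b * z ⟧) + (⟦ q ∣ z ⟧ + pred p)
    ∑-primeTerms x z = begin
      ∑[ T ∈ primeTerms ] ⟦ q ∣ affine T x z ⟧
        ≡⟨ ∑-++ (map (λ b → 1 , toℕ b , 0) (allFin q)) _ _ ⟩
      ∑ (map (λ b → 1 , toℕ b , 0) (allFin q)) (λ T → ⟦ q ∣ affine T x z ⟧)
        + (⟦ q ∣ 0 * x + 1 * z + 0 ⟧ + ∑ (replicate (pred p) (0 , 0 , 0)) (λ T → ⟦ q ∣ affine T x z ⟧))
        ≡⟨ cong₂ _+_ (trans (∑-map _ (allFin q) _) (∑-cong (allFin q) λ b → cong ⟦ q ∣_⟧ (normalise₁ x _)))
                     (cong₂ _+_ (cong ⟦ q ∣_⟧ (normalise₂ z)) constants) ⟩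
      (∑[ b ∈ allFin q ] ⟦ q ∣ x + toℕ b * z ⟧) + (⟦ q ∣ z ⟧ + pred p)
        ∎
      where
      open ≡-Reasoning
      normalise₁ : ∀ x y → 1 * x + y + 0 ≡ x + y
      normalise₁ = solve-∀
      normalise₂ : ∀ z → 0 * x + 1 * z + 0 ≡ z
      normalise₂ = solve-∀
      constants : ∑ (replicate (pred p) (0 , 0 , 0)) (λ T → ⟦ q ∣ affine T x z ⟧) ≡ pred p
      constants = trans (∑-replicate (pred p) _ _) (trans (cong (pred p *_) (⟦∣⟧≡1 (q ∣0))) (*-identityʳ (pred p)))

    private
      ∑-primeTerms-∣ : ∀ x {z} → q ∣ z → ∑[ T ∈ primeTerms ] ⟦ q ∣ affine T x z ⟧ ≈ q * ⟦ q ∣ x ⟧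
      ∑-primeTerms-∣ x {z} q∣z = begin
        ∑[ T ∈ primeTerms ] ⟦ q ∣ affine T x z ⟧                         ≡⟨ ∑-primeTerms x z ⟩
        (∑[ b ∈ allFin q ] ⟦ q ∣ x + toℕ b * z ⟧) + (⟦ q ∣ z ⟧ + pred p)
          ≡⟨ cong₂ _+_ (∑-⟦∣⟧-linear-∣ x q∣z) (cong (_+ pred p) (⟦∣⟧≡1 q∣z)) ⟩
        q * ⟦ q ∣ x ⟧ + suc (pred p)                                     ≡⟨ cong (_ +_) (suc-pred p) ⟩
        q * ⟦ q ∣ x ⟧ + p                                                ≈⟨ +-modulus-≈ _ ⟩
        q * ⟦ q ∣ x ⟧                                                    ∎
        where open ≈-Reasoning

      ∑-primeTerms-∤ : ∀ x {z} → ¬ q ∣ z → ∑[ T ∈ primeTerms ] ⟦ q ∣ affine T x z ⟧ ≈ 0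
      ∑-primeTerms-∤ x {z} q∤z = begin
        ∑[ T ∈ primeTerms ] ⟦ q ∣ affine T x z ⟧                         ≡⟨ ∑-primeTerms x z ⟩
        (∑[ b ∈ allFin q ] ⟦ q ∣ x + toℕ b * z ⟧) + (⟦ q ∣ z ⟧ + pred p)
          ≡⟨ cong₂ _+_ (∑-⟦∣⟧-linear q-prime x q∤z) (cong (_+ pred p) (⟦∣⟧≡0 q∤z)) ⟩
        suc (pred p)                                                     ≡⟨ suc-pred p ⟩
        p                                                                ≈⟨ +-modulus-≈ 0 ⟩
        0                                                                ∎
        where open ≈-Reasoning

    ∑-primeTerms-≈ : ∀ x z → ∑[ T ∈ primeTerms ] ⟦ q ∣ affine T x z ⟧ ≈ q * (⟦ q ∣ x ⟧ * ⟦ q ∣ z ⟧)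
    ∑-primeTerms-≈ x z with q ∣? z
    ... | yes q∣z = trans (∑-primeTerms-∣ x q∣z) (cong (λ t → q * t % p) (sym (*-identityʳ _)))
    ... | no  q∤z = trans (∑-primeTerms-∤ x q∤z)
                          (cong (_% p) (sym (trans (cong (q *_) (*-zeroʳ ⟦ q ∣ x ⟧)) (*-zeroʳ q))))

  productFormula-prime : Prime p → ∀ {q} .{{_ : NonZero q}} → Prime q → ¬ p ∣ q → ∃ (IsProductFormula q)
  productFormula-prime p-prime {q} q-prime p∤q = copies i (primeTerms q-prime) , λ x z → begin
    ∑ (copies i (primeTerms q-prime)) (λ T → ⟦ q ∣ affine T x z ⟧)   ≡⟨ ∑-copies i (primeTerms q-prime) _ ⟩
    i * ∑ (primeTerms q-prime) (λ T → ⟦ q ∣ affine T x z ⟧)         ≈⟨ ≈-*ˡ i (∑-primeTerms-≈ q-prime x z) ⟩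
    i * (q * (⟦ q ∣ x ⟧ * ⟦ q ∣ z ⟧))                               ≡⟨ *-assoc i q _ ⟨
    i * q * (⟦ q ∣ x ⟧ * ⟦ q ∣ z ⟧)                                 ≡⟨ cong (_* (⟦ q ∣ x ⟧ * ⟦ q ∣ z ⟧)) (*-comm i q) ⟩
    q * i * (⟦ q ∣ x ⟧ * ⟦ q ∣ z ⟧)                                 ≈⟨ ≈-* (*-inv p-prime p∤q) refl ⟩
    1 * (⟦ q ∣ x ⟧ * ⟦ q ∣ z ⟧)                                     ≡⟨ *-identityˡ _ ⟩
    ⟦ q ∣ x ⟧ * ⟦ q ∣ z ⟧                                           ∎
    where
    open ≈-Reasoning
    i : ℕ
    i = inv p-prime q

  productFormula-∏ : Prime p → ∀ qs → All Prime qs → SquareFree (product qs) → ¬ p ∣ product qs →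
                     ∃ (IsProductFormula (product qs))
  productFormula-∏ p-prime []       _                  _  _   = (0 , 0 , 0) ∷ [] , productFormula-1
  productFormula-∏ p-prime (q ∷ qs) (q-prime ∷ qs-prime) sf p∤∏
    with productFormula-prime p-prime {{prime⇒nonZero q-prime}} q-prime (p∤∏ ∘ ∣m⇒∣m*n (product qs))
       | productFormula-∏ p-prime qs qs-prime (λ r r-prime r²∣ → sf r r-prime (∣n⇒∣m*n q r²∣))
                                               (p∤∏ ∘ ∣n⇒∣m*n q)
  ... | A , A-ok | B , B-ok = crtTerms q (product qs) A B , productFormula-coprime A B q⊥∏qs A-ok B-ok
    where
    q⊥∏qs : Coprime q (product qs)
    q⊥∏qs = prime∤⇒coprime q-prime (λ q∣∏ → sf q q-prime (*-monoʳ-∣ q q∣∏))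

  productFormula : Prime p → ∀ m .{{_ : NonZero m}} → SquareFree m → ¬ p ∣ m → ∃ (IsProductFormula m)
  productFormula p-prime m sf p∤m =
    subst (∃ ∘ IsProductFormula) (sym m≡∏)
      (productFormula-∏ p-prime factors factorsPrime
                        (subst SquareFree m≡∏ sf) (subst (λ t → ¬ p ∣ t) m≡∏ p∤m))
    where open PrimeFactorisation (factorise m) renaming (isFactorisation to m≡∏)

-- Polynomials with natural coefficients

module Polynomials (k : ℕ) where

  -- Letter 0 stands for the constant 1, so words of length D represent all monomials of
  -- degree at most D in the letters 1, …, k.
  Monomial : ℕ → Set
  Monomial D = Vec (Fin (suc k)) D

  monomials : ∀ D → List (Monomial D)
  monomials zero    = [] ∷ []
  monomials (suc D) = concatMap (λ j → map (j ∷_) (monomials D)) (allFin (suc k))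

  ∑-monomials-suc : ∀ D (F : Monomial (suc D) → ℕ) →
                    ∑ (monomials (suc D)) F ≡ ∑[ j ∈ allFin (suc k) ] ∑[ t ∈ monomials D ] F (j ∷ t)
  ∑-monomials-suc D F = trans (∑-concatMap (λ j → map (j ∷_) (monomials D)) (allFin (suc k)) F)
                              (∑-cong (allFin (suc k)) λ j → ∑-map (j ∷_) (monomials D) F)

  ∑-monomials-++ : ∀ D₁ D₂ (F : Monomial (D₁ + D₂) → ℕ) →
                   ∑ (monomials (D₁ + D₂)) F
                     ≡ ∑[ t₁ ∈ monomials D₁ ] ∑[ t₂ ∈ monomials D₂ ] F (t₁ ++ᵛ t₂)
  ∑-monomials-++ zero     D₂ F = sym (+-identityʳ _)
  ∑-monomials-++ (suc D₁) D₂ F = begin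
    ∑ (monomials (suc D₁ + D₂)) F
      ≡⟨ ∑-monomials-suc (D₁ + D₂) F ⟩
    ∑[ j ∈ allFin (suc k) ] ∑[ t ∈ monomials (D₁ + D₂) ] F (j ∷ t)
      ≡⟨ ∑-cong (allFin (suc k)) (λ j → ∑-monomials-++ D₁ D₂ (F ∘ (j ∷_))) ⟩
    ∑[ j ∈ allFin (suc k) ] ∑[ t₁ ∈ monomials D₁ ] ∑[ t₂ ∈ monomials D₂ ] F (j ∷ t₁ ++ᵛ t₂)
      ≡⟨ ∑-monomials-suc D₁ _ ⟨
    ∑[ t₁ ∈ monomials (suc D₁) ] ∑[ t₂ ∈ monomials D₂ ] F (t₁ ++ᵛ t₂)
      ∎
    where open ≡-Reasoning

  length-monomials : ∀ D → length (monomials D) ≡ suc k ^ D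
  length-monomials zero    = refl
  length-monomials (suc D) = begin
    length (monomials (suc D))
      ≡⟨ length-concatMap (λ j → map (j ∷_) (monomials D)) (allFin (suc k)) ⟩
    ∑[ j ∈ allFin (suc k) ] length (map (j ∷_) (monomials D))
      ≡⟨ ∑-cong (allFin (suc k)) (λ j → length-map (j ∷_) (monomials D)) ⟩
    ∑[ j ∈ allFin (suc k) ] length (monomials D)
      ≡⟨ ∑-const (allFin (suc k)) _ ⟩
    length (allFin (suc k)) * length (monomials D)
      ≡⟨ cong₂ _*_ (length-allFin (suc k)) (length-monomials D) ⟩
    suc k * suc k ^ D
      ∎
    where open ≡-Reasoning

  Poly : ℕ → Set
  Poly D = Monomial D → ℕ

  constant : ∀ {D} → ℕ → Poly D
  constant c []          = c
  constant c (zero ∷ t)  = constant c t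
  constant c (suc _ ∷ _) = 0

  var : Fin (suc k) → Poly 1
  var j (i ∷ []) = 𝟙[ j ≡ i ]

  infixl 6 _+ᴾ_
  infixl 7 _*ᴾ_ _·ᴾ_

  _+ᴾ_ : ∀ {D} → Poly D → Poly D → Poly D
  (P +ᴾ Q) t = P t + Q t

  _·ᴾ_ : ∀ {D} → ℕ → Poly D → Poly D
  (c ·ᴾ P) t = c * P t

  _*ᴾ_ : ∀ {D₁ D₂} → Poly D₁ → Poly D₂ → Poly (D₁ + D₂)
  _*ᴾ_ {D₁} P Q t = P (take D₁ t) * Q (drop D₁ t)

  ∑ᴾ : ∀ {D} → List A → (A → Poly D) → Poly D
  ∑ᴾ xs f t = ∑[ x ∈ xs ] f x t

  -- At most n factors, padded with 1 to degree n * D; surplus factors are dropped (junk case).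
  ∏ᴾ : ∀ {D} n → List (Poly D) → Poly (n * D)
  ∏ᴾ n       []       = constant 1
  ∏ᴾ zero    (_ ∷ _)  = constant 1
  ∏ᴾ (suc n) (P ∷ Ps) = P *ᴾ ∏ᴾ n Ps

  module Evaluation (W : Fin (suc k) → ℕ) (W₀ : W zero ≡ 1) where

    monomial : ∀ {D} → Monomial D → ℕ
    monomial []      = 1
    monomial (j ∷ t) = W j * monomial t

    eval : ∀ {D} → Poly D → ℕ
    eval {D} P = ∑[ t ∈ monomials D ] P t * monomial t

    monomial-++ : ∀ {D₁ D₂} (t₁ : Monomial D₁) (t₂ : Monomial D₂) →
                  monomial (t₁ ++ᵛ t₂) ≡ monomial t₁ * monomial t₂
    monomial-++ []       t₂ = sym (+-identityʳ _)
    monomial-++ (j ∷ t₁) t₂ = trans (cong (W j *_) (monomial-++ t₁ t₂)) (sym (*-assoc (W j) _ _))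

    eval-constant : ∀ {D} c → eval (constant {D} c) ≡ c
    eval-constant {zero}  c = trans (+-identityʳ _) (*-identityʳ c)
    eval-constant {suc D} c = begin
      eval (constant {suc D} c)
        ≡⟨ trans (∑-monomials-suc D _) (∑-allFin-suc k _) ⟩
      (∑[ t ∈ monomials D ] constant c t * (W zero * monomial t))
        + (∑[ j ∈ allFin k ] ∑[ t ∈ monomials D ] 0)
        ≡⟨ cong₂ _+_ (∑-cong (monomials D) λ t → cong (λ w → constant c t * (w * monomial t)) W₀)
                     (trans (∑-cong (allFin k) λ _ → ∑-zero (monomials D)) (∑-zero (allFin k))) ⟩
      (∑[ t ∈ monomials D ] constant c t * (1 * monomial t)) + 0
        ≡⟨ trans (+-identityʳ _) (∑-cong (monomials D) λ t → cong (constant c t *_) (*-identityˡ _)) ⟩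
      eval (constant {D} c)
        ≡⟨ eval-constant {D} c ⟩
      c ∎
      where open ≡-Reasoning

    eval-var : ∀ j → eval (var j) ≡ W j
    eval-var j = begin
      eval (var j)                              ≡⟨ ∑-monomials-suc 0 _ ⟩
      ∑[ i ∈ allFin (suc k) ] (𝟙[ j ≡ i ] * (W i * 1) + 0)
        ≡⟨ ∑-cong (allFin (suc k)) (λ i → trans (+-identityʳ _) (cong (𝟙[ j ≡ i ] *_) (*-identityʳ (W i)))) ⟩
      ∑[ i ∈ allFin (suc k) ] 𝟙[ j ≡ i ] * W i  ≡⟨ ∑-𝟙 j W ⟩
      W j                                       ∎
      where open ≡-Reasoning

    eval-+ : ∀ {D} (P Q : Poly D) → eval (P +ᴾ Q) ≡ eval P + eval Q
    eval-+ {D} P Q = trans (∑-cong (monomials D) λ t → *-distribʳ-+ (monomial t) (P t) (Q t)) (∑-+ (monomials D) _ _)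

    eval-· : ∀ {D} c (P : Poly D) → eval (c ·ᴾ P) ≡ c * eval P
    eval-· {D} c P = trans (∑-cong (monomials D) λ t → *-assoc c (P t) _) (sym (*-distribˡ-∑ c (monomials D) _))

    eval-∑ : ∀ {D} (xs : List A) (f : A → Poly D) → eval (∑ᴾ xs f) ≡ ∑[ x ∈ xs ] eval (f x)
    eval-∑ {D = D} xs f = trans (∑-cong (monomials D) λ t → *-distribʳ-∑ (monomial t) xs (λ x → f x t))
                            (∑-swap (monomials D) xs _)

    eval-* : ∀ {D₁ D₂} (P : Poly D₁) (Q : Poly D₂) → eval (P *ᴾ Q) ≡ eval P * eval Q
    eval-* {D₁} {D₂} P Q = begin
      eval (P *ᴾ Q)
        ≡⟨ ∑-monomials-++ D₁ D₂ _ ⟩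
      ∑[ t₁ ∈ monomials D₁ ] ∑[ t₂ ∈ monomials D₂ ] (P *ᴾ Q) (t₁ ++ᵛ t₂) * monomial (t₁ ++ᵛ t₂)
        ≡⟨ ∑-cong (monomials D₁) (λ t₁ → ∑-cong (monomials D₂) λ t₂ → split t₁ t₂) ⟩
      ∑[ t₁ ∈ monomials D₁ ] ∑[ t₂ ∈ monomials D₂ ] (P t₁ * monomial t₁) * (Q t₂ * monomial t₂)
        ≡⟨ ∑-*-∑ (monomials D₁) (monomials D₂) _ _ ⟨
      eval P * eval Q
        ∎
      where
      open ≡-Reasoning
      split : ∀ t₁ t₂ → (P *ᴾ Q) (t₁ ++ᵛ t₂) * monomial (t₁ ++ᵛ t₂)
                        ≡ (P t₁ * monomial t₁) * (Q t₂ * monomial t₂)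
      split t₁ t₂ =
        trans (cong₂ (λ u v → P u * Q v * monomial (t₁ ++ᵛ t₂))
                     (++-injectiveˡ _ t₁ (take++drop≡id D₁ (t₁ ++ᵛ t₂)))
                     (++-injectiveʳ _ t₁ (take++drop≡id D₁ (t₁ ++ᵛ t₂))))
              (trans (cong (P t₁ * Q t₂ *_) (monomial-++ t₁ t₂)) (*-interchange (P t₁) (Q t₂) _ _))

    eval-∏ : ∀ {D} n (Ps : List (Poly D)) → length Ps ≤ n → eval (∏ᴾ n Ps) ≡ product (map eval Ps)
    eval-∏ {D} n   []       _         = eval-constant {n * D} 1
    eval-∏ (suc n) (P ∷ Ps) (s≤s ≤n) = trans (eval-* P (∏ᴾ n Ps)) (cong (eval P *_) (eval-∏ n Ps ≤n))

-- Residue indicators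

module Residues {p : ℕ} .{{_ : NonZero p}} (p-prime : Prime p) (k : ℕ) where
  open Polynomials k
  open Modular p

  normalisedDifference : ∀ {D} → Poly D → Fin p → Fin p → Poly D
  normalisedDifference s a b = inv p-prime (toℕ a + (p ∸ toℕ b)) ·ᴾ (s +ᴾ constant (p ∸ toℕ b))

  lagrangeFactor : ∀ {D} → Poly D → Fin p → Fin p → Poly D
  lagrangeFactor s a b = if ⌊ b ≟ᶠ a ⌋ then constant 1 else normalisedDifference s a b

  -- Lagrange's indicator ∏_{b ≠ a} (s − b) / (a − b) of s ≡ a, with the factor 1 at b = a
  -- keeping the degree at p * D.
  isResidue : ∀ {D} → Poly D → Fin p → Poly (p * D)
  isResidue s a = ∏ᴾ p (tabulate (lagrangeFactor s a))

  module _ (W : Fin (suc k) → ℕ) (W₀ : W zero ≡ 1) where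
    open Evaluation W W₀

    private
      eval-lagrangeFactor-≡ : ∀ {D} (s : Poly D) {a b} → b ≡ a → eval (lagrangeFactor s a b) ≡ 1
      eval-lagrangeFactor-≡ {D} s {a} {b} b≡a =
        trans (cong (λ c → eval (if c then constant 1 else normalisedDifference s a b)) (⌊≟⌋-true b≡a))
              (eval-constant {D} 1)

      eval-lagrangeFactor-≢ : ∀ {D} (s : Poly D) {a b} → b ≢ a →
        eval (lagrangeFactor s a b) ≡ inv p-prime (toℕ a + (p ∸ toℕ b)) * (eval s + (p ∸ toℕ b))
      eval-lagrangeFactor-≢ {D} s {a} {b} b≢a = begin
        eval (lagrangeFactor s a b)
          ≡⟨ cong (λ c → eval (if c then constant 1 else normalisedDifference s a b)) (⌊≟⌋-false b≢a) ⟩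
        eval (normalisedDifference s a b)
          ≡⟨ eval-· (inv p-prime (toℕ a + (p ∸ toℕ b))) (s +ᴾ constant (p ∸ toℕ b)) ⟩
        inv p-prime (toℕ a + (p ∸ toℕ b)) * eval (s +ᴾ constant (p ∸ toℕ b))
          ≡⟨ cong (inv p-prime (toℕ a + (p ∸ toℕ b)) *_)
                  (trans (eval-+ s (constant (p ∸ toℕ b))) (cong (eval s +_) (eval-constant {D} _))) ⟩
        inv p-prime (toℕ a + (p ∸ toℕ b)) * (eval s + (p ∸ toℕ b))
          ∎
        where open ≡-Reasoning

      lagrangeFactor-≈1 : ∀ {D} (s : Poly D) a → eval s ≈ toℕ a → ∀ b → eval (lagrangeFactor s a b) ≈ 1
      lagrangeFactor-≈1 s a s≈a b = by-cases (b ≟ᶠ a)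
        where
        d : ℕ
        d = toℕ a + (p ∸ toℕ b)
        by-cases : Dec (b ≡ a) → eval (lagrangeFactor s a b) ≈ 1
        by-cases (yes b≡a) = cong (_% p) (eval-lagrangeFactor-≡ s b≡a)
        by-cases (no  b≢a) = begin
          eval (lagrangeFactor s a b)            ≡⟨ eval-lagrangeFactor-≢ s b≢a ⟩
          inv p-prime d * (eval s + (p ∸ toℕ b)) ≈⟨ ≈-*ˡ (inv p-prime d) (≈-+ s≈a refl) ⟩
          inv p-prime d * d                      ≡⟨ *-comm (inv p-prime d) d ⟩
          d * inv p-prime d                      ≈⟨ *-inv p-prime (b≢a ∘ sym ∘ ∣-difference⇒≡ a b) ⟩
          1                                      ∎
          where open ≈-Reasoning

      lagrangeFactor-≈0 : ∀ {D} (s : Poly D) {a r} → r ≢ a → eval s ≈ toℕ r → eval (lagrangeFactor s a r) ≈ 0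
      lagrangeFactor-≈0 s {a} {r} r≢a s≈r = begin
        eval (lagrangeFactor s a r)            ≡⟨ eval-lagrangeFactor-≢ s r≢a ⟩
        inv p-prime d * (eval s + (p ∸ toℕ r)) ≈⟨ ≈-*ˡ (inv p-prime d) (≈-+ s≈r refl) ⟩
        inv p-prime d * (toℕ r + (p ∸ toℕ r))  ≡⟨ cong (inv p-prime d *_) (m+[n∸m]≡n (<⇒≤ (toℕ<n r))) ⟩
        inv p-prime d * p                      ≈⟨ multiple-≈0 (inv p-prime d) ⟩
        0                                      ∎
        where
        open ≈-Reasoning
        d : ℕ
        d = toℕ a + (p ∸ toℕ r)

    eval-isResidue : ∀ {D} (s : Poly D) a r → eval s ≈ toℕ r → eval (isResidue s a) ≈ 𝟙[ r ≡ a ]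
    eval-isResidue s a r s≈r = begin
      eval (isResidue s a)
        ≡⟨ eval-∏ p (tabulate (lagrangeFactor s a)) (≤-reflexive (length-tabulate (lagrangeFactor s a))) ⟩
      product (map eval (tabulate (lagrangeFactor s a)))
        ≡⟨ cong product (map-tabulate (lagrangeFactor s a) eval) ⟩
      product (tabulate (eval ∘ lagrangeFactor s a))
        ≈⟨ by-cases (r ≟ᶠ a) ⟩
      𝟙[ r ≡ a ]
        ∎
      where
      open ≈-Reasoning
      by-cases : Dec (r ≡ a) → product (tabulate (eval ∘ lagrangeFactor s a)) ≈ 𝟙[ r ≡ a ]
      by-cases (yes refl) = trans (product-≈1 (All.tabulate⁺ (lagrangeFactor-≈1 s a s≈r)))
                                  (cong (_% p) (sym (𝟙-≡ refl)))
      by-cases (no  r≢a)  = trans (product-≈0 (Any.tabulate⁺ r (lagrangeFactor-≈0 s r≢a s≈r)))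
                                  (cong (_% p) (sym (𝟙-≢ r≢a)))

-- MOD_m gates

module Gates {m p : ℕ} .{{_ : NonZero m}} .{{_ : NonZero p}}
             (L : List Affine) (L-ok : ProductFormulas.IsProductFormula p m L) (k₁ : ℕ) where
  open Modular p

  Gate : Set
  Gate = List (Fin k₁) × (Fin m → Bool)

  wireSum : List (Fin k₁) → (Fin k₁ → Bool) → ℕ
  wireSum ws y = ∑[ w ∈ ws ] bit (y w)

  value : (Fin k₁ → Bool) → Gate → ℕ
  value y (ws , acc) = bit (evalMOD m acc ws y)

  unitGate : Gate
  unitGate = [] , λ _ → true

  value-residues : ∀ y ws acc →
                   value y (ws , acc) ≡ ∑[ a ∈ allFin m ] bit (acc a) * ⟦ m ∣ wireSum ws y + (m ∸ toℕ a) ⟧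
  value-residues y ws acc = sym (begin
    ∑[ a ∈ allFin m ] bit (acc a) * ⟦ m ∣ wireSum ws y + (m ∸ toℕ a) ⟧
      ≡⟨ ∑-cong (allFin m) (λ a → trans (cong (bit (acc a) *_) (⟦∣⟧-residue (wireSum ws y) a))
                                        (*-comm (bit (acc a)) _)) ⟩
    ∑[ a ∈ allFin m ] 𝟙[ wireSum ws y mod m ≡ a ] * bit (acc a)
      ≡⟨ ∑-𝟙 (wireSum ws y mod m) (bit ∘ acc) ⟩
    value y (ws , acc)
      ∎)
    where open ≡-Reasoning

  pairGate : Gate → Gate → Fin m → Fin m → Affine → Gate
  pairGate (ws₁ , acc₁) (ws₂ , acc₂) a b (α , β , γ) =
    copies α ws₁ ++ copies β ws₂ ,
    λ r → acc₁ a ∧ acc₂ b ∧ does (m ∣? toℕ r + (α * (m ∸ toℕ a) + β * (m ∸ toℕ b) + γ))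

  value-pairGate : ∀ y ws₁ acc₁ ws₂ acc₂ a b T →
    value y (pairGate (ws₁ , acc₁) (ws₂ , acc₂) a b T)
      ≡ bit (acc₁ a) * (bit (acc₂ b) *
          ⟦ m ∣ affine T (wireSum ws₁ y + (m ∸ toℕ a)) (wireSum ws₂ y + (m ∸ toℕ b)) ⟧)
  value-pairGate y ws₁ acc₁ ws₂ acc₂ a b T@(α , β , γ) =
    trans (bit-∧ (acc₁ a) _) (cong (bit (acc₁ a) *_) (trans (bit-∧ (acc₂ b) _) (cong (bit (acc₂ b) *_) shifted-test)))
    where
    u c : ℕ
    u = wireSum (copies α ws₁ ++ copies β ws₂) y
    c = α * (m ∸ toℕ a) + β * (m ∸ toℕ b) + γ
    u≡ : u ≡ α * wireSum ws₁ y + β * wireSum ws₂ y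
    u≡ = trans (∑-++ (copies α ws₁) (copies β ws₂) _) (cong₂ _+_ (∑-copies α ws₁ _) (∑-copies β ws₂ _))
    regroup : ∀ α β γ u₁ u₂ d₁ d₂ →
              α * u₁ + β * u₂ + (α * d₁ + β * d₂ + γ) ≡ α * (u₁ + d₁) + β * (u₂ + d₂) + γ
    regroup = solve-∀
    shifted-test : ⟦ m ∣ toℕ (u mod m) + c ⟧
                   ≡ ⟦ m ∣ affine T (wireSum ws₁ y + (m ∸ toℕ a)) (wireSum ws₂ y + (m ∸ toℕ b)) ⟧
    shifted-test = trans (⟦∣⟧-cong m (Modular.≈-+ m (Modular.toℕ-mod-≈ m u) refl))
                         (cong ⟦ m ∣_⟧ (trans (cong (_+ c) u≡) (regroup α β γ _ _ _ _)))

  productGates : Gate → Gate → List Gate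
  productGates g₁ g₂ = concatMap (λ a → concatMap (λ b → map (pairGate g₁ g₂ a b) L) (allFin m)) (allFin m)

  length-productGates : ∀ g₁ g₂ → length (productGates g₁ g₂) ≡ m * (m * length L)
  length-productGates g₁ g₂ = begin
    length (productGates g₁ g₂)
      ≡⟨ length-concatMap _ (allFin m) ⟩
    ∑[ a ∈ allFin m ] length (concatMap (λ b → map (pairGate g₁ g₂ a b) L) (allFin m))
      ≡⟨ ∑-cong (allFin m) (λ a → trans (length-concatMap _ (allFin m))
                                        (∑-cong (allFin m) λ b → length-map (pairGate g₁ g₂ a b) L)) ⟩
    ∑[ a ∈ allFin m ] ∑[ b ∈ allFin m ] length L
      ≡⟨ trans (∑-cong (allFin m) λ _ → ∑-const (allFin m) _) (∑-const (allFin m) _) ⟩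
    length (allFin m) * (length (allFin m) * length L)
      ≡⟨ cong (λ n → n * (n * length L)) (length-allFin m) ⟩
    m * (m * length L)
      ∎
    where open ≡-Reasoning

  ∑-value-productGates : ∀ y g₁ g₂ → ∑ (productGates g₁ g₂) (value y) ≈ value y g₁ * value y g₂
  ∑-value-productGates y g₁@(ws₁ , acc₁) g₂@(ws₂ , acc₂) = begin
    ∑ (productGates g₁ g₂) (value y)
      ≡⟨ trans (∑-concatMap _ (allFin m) _)
               (∑-cong (allFin m) λ a → trans (∑-concatMap _ (allFin m) _) (∑-cong (allFin m) (pairs a))) ⟩
    ∑[ a ∈ allFin m ] ∑[ b ∈ allFin m ] bit (acc₁ a) * (bit (acc₂ b) * (∑[ T ∈ L ] ⟦ m ∣ affine T (x a) (z b) ⟧))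
      ≈⟨ ≈-∑ (allFin m) (λ a → ≈-∑ (allFin m) λ b →
           ≈-*ˡ (bit (acc₁ a)) (≈-*ˡ (bit (acc₂ b)) (L-ok (x a) (z b)))) ⟩
    ∑[ a ∈ allFin m ] ∑[ b ∈ allFin m ] bit (acc₁ a) * (bit (acc₂ b) * (⟦ m ∣ x a ⟧ * ⟦ m ∣ z b ⟧))
      ≡⟨ ∑-cong (allFin m) (λ a → ∑-cong (allFin m) λ b → rearrange (bit (acc₁ a)) (bit (acc₂ b)) _ _) ⟩
    ∑[ a ∈ allFin m ] ∑[ b ∈ allFin m ] (bit (acc₁ a) * ⟦ m ∣ x a ⟧) * (bit (acc₂ b) * ⟦ m ∣ z b ⟧)
      ≡⟨ ∑-*-∑ (allFin m) (allFin m) _ _ ⟨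
    (∑[ a ∈ allFin m ] bit (acc₁ a) * ⟦ m ∣ x a ⟧) * (∑[ b ∈ allFin m ] bit (acc₂ b) * ⟦ m ∣ z b ⟧)
      ≡⟨ cong₂ _*_ (value-residues y ws₁ acc₁) (value-residues y ws₂ acc₂) ⟨
    value y g₁ * value y g₂
      ∎
    where
    open ≈-Reasoning
    x z : Fin m → ℕ
    x a = wireSum ws₁ y + (m ∸ toℕ a)
    z b = wireSum ws₂ y + (m ∸ toℕ b)
    rearrange : ∀ a b c d → a * (b * (c * d)) ≡ (a * c) * (b * d)
    rearrange = solve-∀
    pairs : ∀ a b → ∑ (map (pairGate g₁ g₂ a b) L) (value y)
                    ≡ bit (acc₁ a) * (bit (acc₂ b) * (∑[ T ∈ L ] ⟦ m ∣ affine T (x a) (z b) ⟧))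
    pairs a b =
      trans (trans (∑-map _ L _) (∑-cong L (value-pairGate y ws₁ acc₁ ws₂ acc₂ a b)))
            (sym (trans (cong (bit (acc₁ a) *_) (*-distribˡ-∑ (bit (acc₂ b)) L _)) (*-distribˡ-∑ (bit (acc₁ a)) L _)))

  module Realisation {k : ℕ} (gates : Fin k → Gate) where
    open Polynomials k

    letterGate : Fin (suc k) → Gate
    letterGate zero    = unitGate
    letterGate (suc j) = gates j

    monomialGates : ∀ {D} → Monomial D → List Gate
    monomialGates []      = unitGate ∷ []
    monomialGates (j ∷ t) = concatMap (productGates (letterGate j)) (monomialGates t)

    polyGates : ∀ {D} → Poly D → List Gate
    polyGates {D} P = concatMap (λ t → copies (P t % p) (monomialGates t)) (monomials D)

    length-monomialGates : ∀ {D} (t : Monomial D) → length (monomialGates t) ≡ (m * (m * length L)) ^ D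
    length-monomialGates []      = refl
    length-monomialGates {suc D} (j ∷ t) = begin
      length (concatMap (productGates (letterGate j)) (monomialGates t))
        ≡⟨ length-concatMap _ (monomialGates t) ⟩
      ∑[ g ∈ monomialGates t ] length (productGates (letterGate j) g)
        ≡⟨ trans (∑-cong (monomialGates t) (length-productGates (letterGate j))) (∑-const (monomialGates t) _) ⟩
      length (monomialGates t) * (m * (m * length L))
        ≡⟨ trans (cong (_* (m * (m * length L))) (length-monomialGates t)) (*-comm _ (m * (m * length L))) ⟩
      (m * (m * length L)) ^ suc D
        ∎
      where open ≡-Reasoning

    length-polyGates : ∀ {D} (P : Poly D) → length (polyGates P) ≤ suc k ^ D * (p * (m * (m * length L)) ^ D)
    length-polyGates {D} P = begin
      length (polyGates P)
        ≡⟨ length-concatMap _ (monomials D) ⟩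
      ∑[ t ∈ monomials D ] length (copies (P t % p) (monomialGates t))
        ≡⟨ ∑-cong (monomials D) (λ t → trans (length-copies (P t % p) (monomialGates t))
                                              (cong (P t % p *_) (length-monomialGates t))) ⟩
      ∑[ t ∈ monomials D ] P t % p * (m * (m * length L)) ^ D
        ≤⟨ ∑-mono-≤ (monomials D) (λ t → *-monoˡ-≤ _ (m%n≤n (P t) p)) ⟩
      ∑[ t ∈ monomials D ] p * (m * (m * length L)) ^ D
        ≡⟨ trans (∑-const (monomials D) _) (cong (_* _) (length-monomials D)) ⟩
      suc k ^ D * (p * (m * (m * length L)) ^ D)
        ∎
      where open ≤-Reasoning

    module _ (y : Fin k₁ → Bool) where
      open Polynomials.Evaluation k (value y ∘ letterGate) refl

      ∑-value-monomialGates : ∀ {D} (t : Monomial D) → ∑ (monomialGates t) (value y) ≈ monomial t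
      ∑-value-monomialGates []      = refl
      ∑-value-monomialGates (j ∷ t) = begin
        ∑ (concatMap (productGates (letterGate j)) (monomialGates t)) (value y)
          ≡⟨ ∑-concatMap _ (monomialGates t) _ ⟩
        ∑[ g ∈ monomialGates t ] ∑ (productGates (letterGate j) g) (value y)
          ≈⟨ ≈-∑ (monomialGates t) (∑-value-productGates y (letterGate j)) ⟩
        ∑[ g ∈ monomialGates t ] value y (letterGate j) * value y g
          ≡⟨ *-distribˡ-∑ (value y (letterGate j)) (monomialGates t) (value y) ⟨
        value y (letterGate j) * ∑ (monomialGates t) (value y)
          ≈⟨ ≈-*ˡ (value y (letterGate j)) (∑-value-monomialGates t) ⟩
        value y (letterGate j) * monomial t
          ∎
        where open ≈-Reasoning

      ∑-value-polyGates : ∀ {D} (P : Poly D) → ∑ (polyGates P) (value y) ≈ eval P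
      ∑-value-polyGates {D} P = begin
        ∑ (polyGates P) (value y)
          ≡⟨ trans (∑-concatMap _ (monomials D) _) (∑-cong (monomials D) λ t → ∑-copies (P t % p) (monomialGates t) _) ⟩
        ∑[ t ∈ monomials D ] P t % p * ∑ (monomialGates t) (value y)
          ≈⟨ ≈-∑ (monomials D) (λ t → ≈-* (%-≈ (P t)) (∑-value-monomialGates t)) ⟩
        eval P
          ∎
        where open ≈-Reasoning

-- Translating the circuit

rowWeight : ∀ {k ν p} → Fin ν → Fin k × Mat ν p → ℕ
rowWeight j wα = sum (tabulate λ l → toℕ (proj₂ wα j l))

module Layers {n m p ν d d' : ℕ} .{{_ : NonZero m}} .{{_ : NonZero p}} (Φ : Circ5 n m p ν d d') where
  open Circ5 Φ

  layer₁ : (Fin n → Bool) → Fin k₁ → Bool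
  layer₁ x i = evalAND (and₁ i) x

  layer₂ : (Fin n → Bool) → Fin k₂ → Bool
  layer₂ x i = evalMOD m (acc₂ i) (mod₂ i) (layer₁ x)

  layer₃ : (Fin n → Bool) → Fin k₃ → Bool
  layer₃ x i = evalMOD p (acc₃ i) (mod₃ i) (layer₂ x)

  layer₄ : (Fin n → Bool) → Fin k₄ → Bool
  layer₄ x i = evalAND (and₄ i) (layer₃ x)

module Translation {m p ν d d' : ℕ} .{{_ : NonZero m}} .{{_ : NonZero p}} (p-prime : Prime p)
                   (L : List Affine) (L-ok : ProductFormulas.IsProductFormula p m L)
                   (c : Vecp ν p) {n : ℕ} (Φ : Circ5 n m p ν d d') where
  open Circ5 Φ
  open Layers Φ
  open Modular p
  open Gates L L-ok k₁
  open Polynomials k₂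
  open Residues p-prime k₂
  open Realisation (λ j → mod₂ j , acc₂ j)

  rowSum : (Fin n → Bool) → Fin ν → ℕ
  rowSum x j = (∑[ wα ∈ out ] rowWeight j wα * bit (layer₄ x (proj₁ wα))) + toℕ (δ j)

  modpInput : Fin k₃ → Poly 1
  modpInput i = ∑ᴾ (mod₃ i) (λ j → var (suc j))

  modpGate : Fin k₃ → Poly (p * 1)
  modpGate i = ∑ᴾ (allFin p) (λ a → bit (acc₃ i a) ·ᴾ isResidue (modpInput i) a)

  andGate : Fin k₄ → Poly (d' * (p * 1))
  andGate i = ∏ᴾ d' (map modpGate (and₄ i))

  outputRow : Fin ν → Poly (d' * (p * 1))
  outputRow j = ∑ᴾ out (λ wα → rowWeight j wα ·ᴾ andGate (proj₁ wα)) +ᴾ constant (toℕ (δ j))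

  output : Poly (ν * (p * (d' * (p * 1))))
  output = ∏ᴾ ν (map (λ j → isResidue (outputRow j) (c j)) (allFin ν))

  module Semantics (x : Fin n → Bool) where
    W : Fin (suc k₂) → ℕ
    W = value (layer₁ x) ∘ letterGate

    open Evaluation W refl public

    eval-modpInput : ∀ i → eval (modpInput i) ≡ ∑[ j ∈ mod₃ i ] bit (layer₂ x j)
    eval-modpInput i = trans (eval-∑ (mod₃ i) (λ j → var (suc j))) (∑-cong (mod₃ i) (λ j → eval-var (suc j)))

    eval-modpGate : ∀ i → eval (modpGate i) ≈ bit (layer₃ x i)
    eval-modpGate i = begin
      eval (modpGate i)
        ≡⟨ trans (eval-∑ (allFin p) (λ a → bit (acc₃ i a) ·ᴾ isResidue (modpInput i) a))
                 (∑-cong (allFin p) λ a → eval-· (bit (acc₃ i a)) (isResidue (modpInput i) a)) ⟩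
      ∑[ a ∈ allFin p ] bit (acc₃ i a) * eval (isResidue (modpInput i) a)
        ≈⟨ ≈-∑ (allFin p) (λ a → ≈-*ˡ (bit (acc₃ i a)) (eval-isResidue W refl (modpInput i) a r s≈r)) ⟩
      ∑[ a ∈ allFin p ] bit (acc₃ i a) * 𝟙[ r ≡ a ]
        ≡⟨ trans (∑-cong (allFin p) λ a → *-comm (bit (acc₃ i a)) _) (∑-𝟙 r (bit ∘ acc₃ i)) ⟩
      bit (layer₃ x i)
        ∎
      where
      open ≈-Reasoning
      r : Fin p
      r = (∑[ j ∈ mod₃ i ] bit (layer₂ x j)) mod p
      s≈r : eval (modpInput i) ≈ toℕ r
      s≈r = trans (cong (_% p) (eval-modpInput i)) (sym (toℕ-mod-≈ _))

    eval-andGate : ∀ i → eval (andGate i) ≈ bit (layer₄ x i)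
    eval-andGate i = begin
      eval (andGate i)
        ≡⟨ eval-∏ d' (map modpGate (and₄ i)) (subst (_≤ d') (sym (length-map modpGate (and₄ i))) (fanin₄ i)) ⟩
      product (map eval (map modpGate (and₄ i)))
        ≡⟨ cong product (map-∘ {g = eval} {f = modpGate} (and₄ i)) ⟨
      product (map (eval ∘ modpGate) (and₄ i))
        ≈⟨ ≈-product (and₄ i) eval-modpGate ⟩
      product (map (bit ∘ layer₃ x) (and₄ i))
        ≡⟨ trans (cong product (map-∘ (and₄ i))) (sym (bit-and (map (layer₃ x) (and₄ i)))) ⟩
      bit (layer₄ x i)
        ∎
      where open ≈-Reasoning

    eval-outputRow : ∀ j → eval (outputRow j) ≈ rowSum x j
    eval-outputRow j = begin
      eval (outputRow j)
        ≡⟨ trans (eval-+ (∑ᴾ out (λ wα → rowWeight j wα ·ᴾ andGate (proj₁ wα))) _)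
                 (cong₂ _+_ (trans (eval-∑ out (λ wα → rowWeight j wα ·ᴾ andGate (proj₁ wα)))
                                   (∑-cong out λ wα → eval-· (rowWeight j wα) (andGate (proj₁ wα))))
                            (eval-constant {d' * (p * 1)} (toℕ (δ j)))) ⟩
      (∑[ wα ∈ out ] rowWeight j wα * eval (andGate (proj₁ wα))) + toℕ (δ j)
        ≈⟨ ≈-+ (≈-∑ out λ wα → ≈-*ˡ (rowWeight j wα) (eval-andGate (proj₁ wα))) refl ⟩
      rowSum x j
        ∎
      where open ≈-Reasoning

    eval-output : eval output ≈ bit (eval5 c Φ x)
    eval-output = begin
      eval output
        ≡⟨ eval-∏ ν (map residueRow (allFin ν))
                  (≤-reflexive (trans (length-map residueRow (allFin ν)) (length-allFin ν))) ⟩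
      product (map eval (map residueRow (allFin ν)))
        ≡⟨ cong product (map-∘ {g = eval} {f = residueRow} (allFin ν)) ⟨
      product (map (λ j → eval (isResidue (outputRow j) (c j))) (allFin ν))
        ≈⟨ ≈-product (allFin ν) (λ j → eval-isResidue W refl (outputRow j) (c j) _
                                          (trans (eval-outputRow j) (sym (toℕ-mod-≈ _)))) ⟩
      product (map (λ j → 𝟙[ rowSum x j mod p ≡ c j ]) (allFin ν))
        ≡⟨ cong product (trans (map-tabulate id (bit ∘ matchesRow)) (sym (map-tabulate matchesRow bit))) ⟩
      product (map bit (tabulate matchesRow))
        ≡⟨ bit-and (tabulate matchesRow) ⟨
      bit (eval5 c Φ x)
        ∎
      where
      open ≈-Reasoning
      residueRow : Fin ν → Poly (p * (d' * (p * 1)))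
      residueRow j = isResidue (outputRow j) (c j)
      matchesRow : Fin ν → Bool
      matchesRow j = ⌊ rowSum x j mod p ≟ᶠ c j ⌋

  circuit : Circ3 n m p d
  circuit = record
    { k₁ = k₁ ; and₁ = and₁ ; fanin₁ = fanin₁
    ; k₂ = length gates ; mod₂ = proj₁ ∘ lookup gates ; acc₂ = proj₂ ∘ lookup gates
    ; out = allFin (length gates) ; accOut = λ a → ⌊ toℕ a ≟ 1 ⌋
    }
    where
    gates : List Gate
    gates = polyGates output

  size3-circuit : let D = ν * (p * (d' * (p * 1))) in
                  size3 circuit ≤ k₁ + suc k₂ ^ D * (p * (m * (m * length L)) ^ D) + 1
  size3-circuit = +-monoˡ-≤ 1 (+-monoʳ-≤ k₁ (length-polyGates output))

  private
    decode : ∀ b {N} → N ≈ bit b → ⌊ toℕ (N mod p) ≟ 1 ⌋ ≡ b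
    decode b {N} N≈b =
      trans (cong (λ r → ⌊ r ≟ 1 ⌋) (trans (toℕ-fromℕ< (m%n<n N p)) (trans N≈b (m<n⇒m%n≡m bit<p)))) (bit≟1 b)
      where
      bit<p : bit b < p
      bit<p = ≤-<-trans (bit≤1 b) (nonTrivial⇒n>1 p {{prime⇒nonTrivial p-prime}})
        where
        bit≤1 : ∀ b → bit b ≤ 1
        bit≤1 true  = ≤-refl
        bit≤1 false = z≤n
      bit≟1 : ∀ b → ⌊ bit b ≟ 1 ⌋ ≡ b
      bit≟1 true  = refl
      bit≟1 false = refl

  eval3-circuit : ∀ x → eval3 circuit x ≡ eval5 c Φ x
  eval3-circuit x = decode (eval5 c Φ x) (begin
    ∑[ w ∈ allFin (length (polyGates output)) ] value (layer₁ x) (lookup (polyGates output) w)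
      ≡⟨ ∑-allFin-lookup (polyGates output) (value (layer₁ x)) ⟩
    ∑ (polyGates output) (value (layer₁ x))
      ≈⟨ ∑-value-polyGates (layer₁ x) output ⟩
    Semantics.eval x output
      ≈⟨ Semantics.eval-output x ⟩
    bit (eval5 c Φ x)
      ∎)
    where open ≈-Reasoning

constantCircuit : ∀ {n m p d} .{{_ : NonZero m}} .{{_ : NonZero p}} → Bool → Circ3 n m p d
constantCircuit b = record
  { k₁ = 0 ; and₁ = λ () ; fanin₁ = λ ()
  ; k₂ = 0 ; mod₂ = λ () ; acc₂ = λ ()
  ; out = [] ; accOut = λ _ → b
  }

evalΣ-cong : ∀ {k} ν p .{{_ : NonZero p}} c (ws : List (Fin k × Mat ν p)) δ {y y' : Fin k → Bool} →
             (∀ i → y i ≡ y' i) → evalΣ ν p c ws δ y ≡ evalΣ ν p c ws δ y'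
evalΣ-cong ν p c ws δ y≗y' = cong and (tabulate-cong λ j →
  cong (λ s → ⌊ (s + toℕ (δ j)) mod p ≟ᶠ c j ⌋)
       (∑-cong ws λ wα → cong (λ b → rowWeight j wα * bit b) (y≗y' (proj₁ wα))))

length≤0⇒[] : ∀ {xs : List A} → length xs ≤ 0 → xs ≡ []
length≤0⇒[] {xs = []} _ = refl

eval5-constant : ∀ {n m p ν d d'} .{{_ : NonZero m}} .{{_ : NonZero p}}
                 (c : Vecp ν p) (Φ : Circ5 n m p ν d d') → ν * d' ≡ 0 → ∀ x y → eval5 c Φ x ≡ eval5 c Φ y
eval5-constant {ν = ν} c Φ νd'≡0 x y with m*n≡0⇒m≡0∨n≡0 ν νd'≡0
... | inj₁ refl = refl
... | inj₂ refl = trans (evalΣ-cong _ _ c out δ (and₄-true x))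
                       (sym (evalΣ-cong _ _ c out δ (and₄-true y)))
  where
  open Circ5 Φ
  open Layers Φ
  and₄-true : ∀ x i → layer₄ x i ≡ true
  and₄-true x i = cong (λ ws → evalAND ws (layer₃ x)) (length≤0⇒[] {xs = and₄ i} (fanin₄ i))

size-bound : ∀ {s a b X D E} → 1 ≤ s → 1 ≤ E → D ≤ E → a ≤ s → b ≤ s ^ D * X →
             a + b + 1 ≤ (2 + X) * s ^ E
size-bound {s} {a} {b} {X} {D} {E} 1≤s 1≤E D≤E a≤s b≤sᴰX = begin
  a + b + 1                 ≤⟨ +-mono-≤ (+-mono-≤ a≤sᴱ b≤sᴱX) 1≤sᴱ ⟩
  s ^ E + s ^ E * X + s ^ E ≡⟨ collect (s ^ E) X ⟩
  (2 + X) * s ^ E           ∎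
  where
  open ≤-Reasoning
  instance
    s≢0 : NonZero s
    s≢0 = >-nonZero 1≤s
  1≤sᴱ : 1 ≤ s ^ E
  1≤sᴱ = m^n>0 s E
  a≤sᴱ : a ≤ s ^ E
  a≤sᴱ = ≤-trans a≤s (≤-trans (≤-reflexive (sym (*-identityʳ s))) (^-monoʳ-≤ s 1≤E))
  b≤sᴱX : b ≤ s ^ E * X
  b≤sᴱX = ≤-trans b≤sᴰX (*-monoˡ-≤ X (^-monoʳ-≤ s D≤E))
  collect : ∀ t x → t + t * x + t ≡ (2 + x) * t
  collect = solve-∀

degree≤ : ∀ ν p d' .{{_ : NonZero p}} → ν * (p * (d' * (p * 1))) ≤ ν * d' * p ^ 3
degree≤ ν p d' = begin
  D     ≡⟨ *-identityʳ D ⟨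
  D * 1 ≤⟨ *-monoʳ-≤ D (n≢0⇒n>0 (≢-nonZero⁻¹ p)) ⟩
  D * p ≡⟨ regroup ν p d' ⟩
  ν * d' * p ^ 3 ∎
  where
  open ≤-Reasoning
  D = ν * (p * (d' * (p * 1)))
  regroup : ∀ ν p d' → ν * (p * (d' * (p * 1))) * p ≡ ν * d' * (p * (p * (p * 1)))
  regroup = solve-∀

module _ {n m p ν d d' : ℕ} .{{_ : NonZero m}} .{{_ : NonZero p}} (Φ : Circ5 n m p ν d d') where
  open Circ5 Φ

  1≤size5 : 1 ≤ size5 Φ
  1≤size5 = m≤n+m 1 (k₁ + k₂ + k₃ + k₄)

  k₁≤size5 : k₁ ≤ size5 Φ
  k₁≤size5 = ≤-trans (m≤m+n k₁ k₂) (≤-trans (m≤m+n _ k₃) (≤-trans (m≤m+n _ k₄) (m≤m+n _ 1)))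

  k₂<size5 : suc k₂ ≤ size5 Φ
  k₂<size5 = subst (_≤ size5 Φ) (+-comm k₂ 1)
                   (+-monoˡ-≤ 1 (≤-trans (m≤n+m k₂ k₁) (≤-trans (m≤m+n _ k₃) (m≤m+n _ k₄))))

lemma9p5 : (m p ν d d' : ℕ) .{{_ : NonZero m}} .{{_ : NonZero p}} →
           SquareFree m → Prime p → ¬ (p ∣ m) → (c : Vecp ν p) →
           ∃ λ (K : ℕ) → (n : ℕ) → (Φ : Circ5 n m p ν d d') →
             Σ (Circ3 n m p d) λ Ψ →
               (size3 Ψ ≤ K * size5 Φ ^ (ν * d' * p ^ 3))
               × (∀ (x : Fin n → Bool) → eval3 Ψ x ≡ eval5 c Φ x)
lemma9p5 m p ν d d' sf p-prime p∤m c with ProductFormulas.productFormula p p-prime m sf p∤m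
... | L , L-ok = K , construction
  where
  D X K : ℕ
  D = ν * (p * (d' * (p * 1)))
  X = p * (m * (m * length L)) ^ D
  K = 2 + X

  construction : (n : ℕ) (Φ : Circ5 n m p ν d d') → Σ (Circ3 n m p d) λ Ψ →
                 (size3 Ψ ≤ K * size5 Φ ^ (ν * d' * p ^ 3)) × (∀ x → eval3 Ψ x ≡ eval5 c Φ x)
  construction n Φ with ν * d' * p ^ 3 ≟ 0
  -- For exponent 0 the bound is constant, so the AND layer of Φ cannot be kept.
  ... | yes E≡0 = constantCircuit (eval5 c Φ (λ _ → false)) ,
                  subst (λ e → 1 ≤ K * size5 Φ ^ e) (sym E≡0) (subst (1 ≤_) (sym (*-identityʳ K)) (s≤s z≤n)) ,
                  eval5-constant c Φ (m*n≡0⇒m≡0 (ν * d') (p ^ 3) {{m^n≢0 p 3}} E≡0) (λ _ → false)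
  ... | no  E≢0 = circuit , ≤-trans size3-circuit size-ok , eval3-circuit
    where
    open Translation p-prime L L-ok c Φ
    open Circ5 Φ using (k₁; k₂)
    size-ok : k₁ + suc k₂ ^ D * X + 1 ≤ K * size5 Φ ^ (ν * d' * p ^ 3)
    size-ok = size-bound (1≤size5 Φ) (n≢0⇒n>0 E≢0) (degree≤ ν p d') (k₁≤size5 Φ)
                         (*-monoˡ-≤ X (^-monoˡ-≤ D (k₂<size5 Φ)))
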